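{- Fix an integer $H>0$. If $t$ is a Union tree, then $c(t,x)\ge 0$ for every node $x$ of $t$.
   Context: A tree is $t=(V_t,\mathrm{root}_t,\mathrm{parent}_t)$ with finite node set, a root, and a parent map on non-root nodes such that iterating it from any node reaches the root. $\mathrm{children}(t,x)$ is the set of children of $x$; $\mathrm{size}(t,x)$ is the number of descendants of $x$ including $x$; $\mathrm{size}(t)=\mathrm{size}(t,\mathrm{root}_t)$. For trees $t,s$ with disjoint node sets, $\textsc{merge}(t,s)$ is the tree on $V_t\cup V_s$ with root $\mathrm{root}_t$ in which $\mathrm{root}_s$ becomes a child of $\mathrm{root}_t$, other parents as in $t,s$. Union trees: the least class of trees containing all one-node trees and containing $\textsc{merge}(t,s)$ whenever $t,s$ are in it with $\mathrm{size}(t)\ge\mathrm{size}(s)$. For $W\ge0$, $\mathrm{sumsize}(t,x,W)=\sum\{\mathrm{size}(t,y): y\in\mathrm{children}(t,x),\ \mathrm{size}(t,y)\le W\}$, and $\mathrm{sumlight}(t,x)=\mathrm{sumsize}(t,x,H)$. A node $x$ is light if $\mathrm{size}(t,x)\le H$ and heavy otherwise. The charge is $c(t,x)=0$ if $x$ is light, and $c(t,x)=\mathrm{sumlight}(t,x)-H$ if $x$ is heavy. -}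

module Defs where

open import Data.Nat using (ℕ; zero; suc; _+_; _≤_; _≤?_)
open import Data.List using (List; []; _∷_; _++_; [_]; filter; map)
open import Data.Nat.ListAction using (sum)
open import Data.List.Membership.Propositional using (_∈_)
open import Data.Integer using (ℤ; +_; _-_)
open import Relation.Nullary using (yes; no)

data Tree : Set where
  node : List Tree → Tree

children : Tree → List Tree
children (node ts) = ts

mutual
  size : Tree → ℕ
  size (node ts) = suc (sizes ts)

  sizes : List Tree → ℕ
  sizes []       = 0
  sizes (t ∷ ts) = size t + sizes ts

leaf : Tree
leaf = node []

merge : Tree → Tree → Tree
merge (node ts) s = node (ts ++ [ s ])

data UnionTree : Tree → Set where
  single : UnionTree leaf
  union  : ∀ {t s} → UnionTree t → UnionTree s → size s ≤ size t →
           UnionTree (merge t s)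

-- Nodes of t, identified with the subtree rooted at them:
-- NodeOf u t  means  u is the subtree of t rooted at some node x of t.
data NodeOf : Tree → Tree → Set where
  root  : ∀ {t} → NodeOf t t
  below : ∀ {u c ts} → c ∈ ts → NodeOf u c → NodeOf u (node ts)

-- sumsize(t,x,W), where the tree argument is the subtree rooted at x.
sumsize : Tree → ℕ → ℕ
sumsize x W = sum (map size (filter (λ y → size y ≤? W) (children x)))

module _ (H : ℕ) where
  sumlight : Tree → ℕ
  sumlight x = sumsize x H

  -- charge c(t,x), computed on the subtree rooted at x (value in ℤ).
  charge : Tree → ℤ
  charge x with size x ≤? H
  ... | yes _ = + 0
  ... | no  _ = + sumlight x - + H

module Submission where

-- Record the children of a node in the order in which they
-- were attached by merge.  In a Union tree each child has size at most
-- 1 + (total size of the earlier children): when it was merged, the tree it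
-- joined consisted of the node itself plus those earlier children (and the
-- merge condition says it was no larger).  We call a list of trees with this
-- property, relative to an offset a of size already accumulated, "doubling".
-- Key lemma: for a doubling list, a + (total size) ≥ H implies
-- a + (total size of the light trees) ≥ H, since the first heavy tree (size
-- > H) can only occur once the accumulated size is ≥ H.  For a heavy node x
-- (1 + total size of children > H) this gives sumlight(x) ≥ H, i.e.
-- c(t,x) ≥ 0; light nodes have charge 0.  Every node of a Union tree roots
-- a Union subtree, so the lemma applies to all nodes.

open import Defs
open import Data.Nat using (ℕ; suc; _+_; _<_; _≤?_; z≤n)
  renaming (_≤_ to _≤ℕ_)
open import Data.Nat.Properties
  using (≤-trans; ≤-pred; ≰⇒>; m≤m+n; +-assoc; +-identityʳ)
open import Data.Integer using (+_; _≤_; +≤+)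
open import Data.Integer.Properties using (i≤j⇒0≤j-i)
open import Data.List using (List; []; _∷_; _++_; [_]; filter; map)
open import Data.List.Properties using (filter-accept; filter-reject)
open import Data.List.Membership.Propositional.Properties using (∈-++⁻)
open import Data.List.Relation.Unary.Any using (here)
open import Data.Nat.ListAction using (sum)
open import Data.Sum using (inj₁; inj₂)
open import Relation.Nullary using (¬_; yes; no)
open import Relation.Binary.PropositionalEquality
  using (_≡_; refl; sym; cong; subst)
open Relation.Binary.PropositionalEquality.≡-Reasoning

lightSum : ℕ → List Tree → ℕ
lightSum H ts = sum (map size (filter (λ y → size y ≤? H) ts))

lightSum-light : ∀ H {s} ts → size s ≤ℕ H → lightSum H (s ∷ ts) ≡ size s + lightSum H ts
lightSum-light H ts light = cong (λ l → sum (map size l)) (filter-accept (λ y → size y ≤? H) light)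

lightSum-heavy : ∀ H {s} ts → ¬ size s ≤ℕ H → lightSum H (s ∷ ts) ≡ lightSum H ts
lightSum-heavy H ts heavy = cong (λ l → sum (map size l)) (filter-reject (λ y → size y ≤? H) heavy)

data Doubling : ℕ → List Tree → Set where
  []  : ∀ {a} → Doubling a []
  _∷_ : ∀ {a s ts} → size s ≤ℕ suc a → Doubling (a + size s) ts → Doubling a (s ∷ ts)

doubling-snoc : ∀ {a s} ts → Doubling a ts → size s ≤ℕ suc (a + sizes ts) →
                Doubling a (ts ++ [ s ])
doubling-snoc {a} {s} [] [] s≤ =
  subst (λ k → size s ≤ℕ suc k) (+-identityʳ a) s≤ ∷ []
doubling-snoc {a} {s} (t ∷ ts) (t≤ ∷ d) s≤ =
  t≤ ∷ doubling-snoc ts d (subst (λ k → size s ≤ℕ suc k) (sym (+-assoc a (size t) (sizes ts))) s≤)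

unionTree-doubling : ∀ {t} → UnionTree t → Doubling 0 (children t)
unionTree-doubling single = []
unionTree-doubling (union {node ts} ut _ s≤t) = doubling-snoc ts (unionTree-doubling ut) s≤t

unionTree-node : ∀ {t x} → UnionTree t → NodeOf x t → UnionTree x
unionTree-node single root = single
unionTree-node single (below () _)
unionTree-node ut@(union {node _} _ _ _) root = ut
unionTree-node (union {node ts} ut us _) (below c∈ x∈c) with ∈-++⁻ ts c∈
... | inj₁ c∈ts        = unionTree-node ut (below c∈ts x∈c)
... | inj₂ (here refl) = unionTree-node us x∈c

-- A heavy tree s satisfies
-- H < size s ≤ 1 + a, so the offset alone reaches H; a light tree is moved
-- into the offset and counted on both sides.
doubling-lightSum : ∀ H {a ts} → Doubling a ts →
                    H ≤ℕ a + sizes ts → H ≤ℕ a + lightSum H ts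
doubling-lightSum H [] H≤ = H≤
doubling-lightSum H {a} (_∷_ {s = s} {ts} s≤ d) H≤ with size s ≤? H
... | no heavy =
  subst (λ k → H ≤ℕ a + k) (sym (lightSum-heavy H ts heavy))
        (≤-trans (≤-pred (≤-trans (≰⇒> heavy) s≤)) (m≤m+n a _))
... | yes light = subst (H ≤ℕ_) regroup tail-bound
  where
    tail-bound : H ≤ℕ a + size s + lightSum H ts
    tail-bound = doubling-lightSum H d (subst (H ≤ℕ_) (sym (+-assoc a (size s) (sizes ts))) H≤)

    regroup : a + size s + lightSum H ts ≡ a + lightSum H (s ∷ ts)
    regroup = begin
      a + size s + lightSum H ts     ≡⟨ +-assoc a (size s) (lightSum H ts) ⟩
      a + (size s + lightSum H ts)   ≡⟨ cong (λ k → a + k) (sym (lightSum-light H ts light)) ⟩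
      a + lightSum H (s ∷ ts)        ∎

unionTree-heavy : ∀ H {x} → UnionTree x → ¬ size x ≤ℕ H → H ≤ℕ sumlight H x
unionTree-heavy H {node ts} ux heavy =
  doubling-lightSum H (unionTree-doubling ux) (≤-pred (≰⇒> heavy))

proposition3 : (H : ℕ) → 0 < H → (t : Tree) → UnionTree t →
    (x : Tree) → NodeOf x t → + 0 ≤ charge H x
proposition3 H _ t ut x x∈t with size x ≤? H
... | yes _     = +≤+ z≤n
... | no  heavy = i≤j⇒0≤j-i (+≤+ (unionTree-heavy H (unionTree-node ut x∈t) heavy))
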